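{- Let $n\ge 1$ and $k\ge 1$ be integers. In the group algebra $\mathbb{Q}S_n$, let $$s=\sum_{w\in S_n}\frac{1}{k^n}\binom{n+k-d(w^{ -1})-1}{n}\,w,\qquad c=\frac1n\sum_{i=0}^{n-1}\zeta^i,$$ where $\zeta=(1\,2\,\cdots\,n)$. Then for every $w\in S_n$ the coefficient of $w$ in the product $cs$ equals $$\frac{1}{n k^{n-1}}\binom{n+k-cd(w^{ -1})-1}{n-1}.$$
   Context: Permutations are multiplied by composition, $(\sigma\tau)(x)=\sigma(\tau(x))$, and this is extended bilinearly to the group algebra. For $w\in S_n$, $w$ has a descent at $i$ if $1\le i\le n-1$ and $w(i)>w(i+1)$; $d(w)$ is the number of descents. The number of cyclic descents $cd(w)$ is $d(w)+1$ if $w(n)>w(1)$ and $d(w)$ otherwise. The element $s$ is the $k$-riffle shuffle (Gilbert–Shannon–Reeds model) as an element of the group algebra, and $c$ is a cut at a uniformly chosen position; $cs$ is a $k$-shuffle followed by a cut. -}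

module Defs where

open import Data.Nat as ℕ using (ℕ; zero; suc; _∸_; _^_; NonZero)
open import Data.Nat.Properties using (m^n≢0)
open import Data.Nat.Combinatorics using (_C_)
open import Data.Integer using (+_)
open import Data.Rational using (ℚ; 0ℚ; _+_; _*_; _/_)
open import Data.Fin using (Fin; zero; suc; inject₁; fromℕ; _<_)
open import Data.Fin.Properties using (all?; _≟_; _<?_)
open import Data.Fin.Permutation using (Permutation′; permutation; _⟨$⟩ʳ_; _⟨$⟩ˡ_)
open import Data.List using (List; []; _∷_; map; concatMap; mapMaybe; foldr; filter; length; allFin; upTo)
open import Data.Vec using (Vec; []; _∷_; lookup)
open import Data.Maybe using (Maybe; just; nothing)
open import Data.Product using (_×_; _,_)
open import Relation.Nullary using (yes; no; Dec; does)
open import Relation.Binary.PropositionalEquality using (_≡_)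
open import Data.Bool using (if_then_else_)
open import Function using (_∘_; id)

Perm : ℕ → Set
Perm n = Permutation′ n

QS : ℕ → Set
QS n = Perm n → ℚ

sumℚ : {A : Set} → List A → (A → ℚ) → ℚ
sumℚ xs f = foldr (λ a r → f a + r) 0ℚ xs

allVecs : (n m : ℕ) → List (Vec (Fin n) m)
allVecs n zero = [] ∷ []
allVecs n (suc m) = concatMap (λ i → map (i ∷_) (allVecs n m)) (allFin n)

allFuns : (n : ℕ) → List (Fin n → Fin n)
allFuns n = map lookup (allVecs n n)

mkPerm : {n : ℕ} → (Fin n → Fin n) × (Fin n → Fin n) → Maybe (Perm n)
mkPerm (f , g) with all? (λ y → f (g y) ≟ y) | all? (λ x → g (f x) ≟ x)
... | yes p | yes q = just (permutation f g p q)
... | _     | _     = nothing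

allPerms : (n : ℕ) → List (Perm n)
allPerms n = mapMaybe mkPerm
  (concatMap (λ f → map (λ g → (f , g)) (allFuns n)) (allFuns n))

-- Product in the group algebra, with (σ τ)(x) = σ (τ x):
-- coefficient of w in x y is the sum of x(σ) y(τ) over σ τ = w.
_·_ : {n : ℕ} → QS n → QS n → QS n
_·_ {n} x y w = sumℚ (allPerms n) λ σ → sumℚ (allPerms n) λ τ →
  if does (all? (λ i → (σ ⟨$⟩ʳ (τ ⟨$⟩ʳ i)) ≟ (w ⟨$⟩ʳ i)))
  then x σ * y τ else 0ℚ

-- Descents of a map w on Fin (suc m) (positions 1..n are zero..fromℕ m):
-- positions i (1 ≤ i ≤ n-1) with w(i) > w(i+1).
des : {m : ℕ} → (Fin (suc m) → Fin (suc m)) → ℕ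
des {m} w = length (filter (λ i → w (suc i) <? w (inject₁ i)) (allFin m))

cdes : {m : ℕ} → (Fin (suc m) → Fin (suc m)) → ℕ
cdes {m} w = des w ℕ.+ (if does (w zero <? w (fromℕ m)) then 1 else 0)

d : {m : ℕ} → Perm (suc m) → ℕ
d w = des (w ⟨$⟩ʳ_)

cd : {m : ℕ} → Perm (suc m) → ℕ
cd w = cdes (w ⟨$⟩ʳ_)

inv⟨_⟩ : {n : ℕ} → Perm n → (Fin n → Fin n)
inv⟨ w ⟩ = w ⟨$⟩ˡ_

dInv : {m : ℕ} → Perm (suc m) → ℕ
dInv w = des inv⟨ w ⟩

cdInv : {m : ℕ} → Perm (suc m) → ℕ
cdInv w = cdes inv⟨ w ⟩

shuffle : (m k : ℕ) → .{{NonZero k}} → QS (suc m)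
shuffle m k w =
  _/_ (+ (((suc m ℕ.+ k) ∸ dInv w ∸ 1) C suc m)) (k ^ suc m) {{m^n≢0 k (suc m)}}

-- The n-cycle ζ = (1 2 ... n): i ↦ i+1, n ↦ 1.
zeta : {m : ℕ} → Fin (suc m) → Fin (suc m)
zeta {zero} zero = zero
zeta {suc m} zero = suc zero
zeta {suc m} (suc i) with zeta {m} i
... | zero = zero
... | suc j = suc (suc j)

zetaPow : {m : ℕ} → ℕ → Fin (suc m) → Fin (suc m)
zetaPow zero x = x
zetaPow (suc i) x = zeta (zetaPow i x)

cut : (m : ℕ) → QS (suc m)
cut m w = sumℚ (upTo (suc m)) λ i →
  if does (all? (λ x → zetaPow i x ≟ (w ⟨$⟩ʳ x))) then (+ 1) / suc m else 0ℚ

-- Since c averages the rotations ζⁱ, the coefficient of w in cs is (1/n) Σᵢ s(ζ⁻ⁱ w), and the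
-- inverse of ζ⁻ⁱ w is w⁻¹ ζⁱ: the word of w⁻¹ read cyclically from a shifted starting point.
-- Such a rotation keeps every cyclic descent of w⁻¹ except the one straddling its two ends, so
-- for exactly c = cd(w⁻¹) of the n rotations it has c - 1 descents and for the others c. With
-- N = n + k the sum is therefore c·C(N-c, n) + (n-c)·C(N-c-1, n), which Pascal's rule and the
-- absorption identity (j+1)·C(M, j+1) = (M-j)·C(M, j) reduce to k·C(N-c-1, n-1).

module Submission where

open import Algebra.Bundles using (CommutativeSemiring; CommutativeRing)
import Algebra.Properties.Semiring.Sum as Sum
open import Data.Bool using (Bool; true; false; not; if_then_else_)
open import Data.Fin using (Fin; toℕ; inject₁; fromℕ; _<?_)
open import Data.Fin.Permutation as Perm using (permutation; _⟨$⟩ʳ_; _⟨$⟩ˡ_; _∘ₚ_; inverseˡ; inverseʳ)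
  renaming (_≈_ to _≈ₚ_)
open import Data.Fin.Properties using (all?; _≟_)
open import Data.Integer using (+_)
open import Data.List using (List; upTo)
open import Data.Nat using (ℕ; zero; suc; _∸_; _^_; NonZero)
import Data.Nat as ℕ
open import Data.Nat.Combinatorics using (_C_)
open import Data.Nat.Properties as ℕP using (m^n≢0; m*n≢0)
open import Data.Product using (_×_; _,_; proj₁; proj₂; ∃)
open import Data.Rational as ℚ using (ℚ; 0ℚ; _/_)
import Data.Rational.Properties as ℚP
open import Function using (_∘_; id)
open import Relation.Binary.PropositionalEquality as ≡ using (_≡_; _≢_; _≗_; cong)
open import Relation.Nullary using (¬_; Dec; yes; no; does; contradiction)

open import Defs

module ℕΣ = Sum ℕP.+-*-semiring
module ℚΣ = Sum (CommutativeRing.semiring ℚP.+-*-commutativeRing)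

module Permutations where

  open import Data.Maybe using (just)

  module _ {n : ℕ} where

    flip-cong : (σ τ : Perm n) → σ ≈ₚ τ → Perm.flip σ ≈ₚ Perm.flip τ
    flip-cong σ τ σ≈τ y = begin
      σ ⟨$⟩ˡ y                    ≡⟨ cong (σ ⟨$⟩ˡ_) (inverseʳ τ) ⟨
      σ ⟨$⟩ˡ (τ ⟨$⟩ʳ (τ ⟨$⟩ˡ y))  ≡⟨ cong (σ ⟨$⟩ˡ_) (σ≈τ (τ ⟨$⟩ˡ y)) ⟨
      σ ⟨$⟩ˡ (σ ⟨$⟩ʳ (τ ⟨$⟩ˡ y))  ≡⟨ inverseˡ σ ⟩
      τ ⟨$⟩ˡ y                    ∎
      where open ≡.≡-Reasoning

    mkPerm-sound : ∀ (f g : Fin n → Fin n) σ → mkPerm (f , g) ≡ just σ → (σ ⟨$⟩ʳ_) ≗ f × (σ ⟨$⟩ˡ_) ≗ g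
    mkPerm-sound f g σ eq with all? (λ y → f (g y) ≟ y) | all? (λ x → g (f x) ≟ x)
    mkPerm-sound f g σ ≡.refl | yes _ | yes _ = (λ _ → ≡.refl) , (λ _ → ≡.refl)

    mkPerm-complete : ∀ (f g : Fin n → Fin n) → f ∘ g ≗ id → g ∘ f ≗ id → ∃ λ σ → mkPerm (f , g) ≡ just σ
    mkPerm-complete f g fg≗id gf≗id with all? (λ y → f (g y) ≟ y) | all? (λ x → g (f x) ≟ x)
    ... | yes _ | yes _  = _ , ≡.refl
    ... | yes _ | no ¬gf = contradiction gf≗id ¬gf
    ... | no ¬fg | _     = contradiction fg≗id ¬fg

open Permutations

module ListSum {c ℓ} (R : CommutativeSemiring c ℓ) where

  open CommutativeSemiring R hiding (zero)
  open import Data.Fin using (zero; suc; punchIn)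
  open import Data.Fin.Properties using (punchInᵢ≢i)
  open import Data.List using ([]; _∷_; _++_; map; concatMap; mapMaybe; foldr; applyUpTo; tabulate; allFin)
  open import Data.Maybe using (Maybe; just; nothing; maybe′)
  open import Data.Vec using (Vec; []; _∷_; lookup)
  import Data.Vec as Vec
  open import Data.Vec.Properties using (lookup∘tabulate; tabulate∘lookup; tabulate-cong)
  open import Algebra.Properties.Semiring.Sum semiring using (sum; sum-remove; sum-cong-≋; sum-replicate-zero)
  open import Relation.Binary.Reasoning.Setoid setoid

  sumOver : {A : Set} → List A → (A → Carrier) → Carrier
  sumOver xs f = foldr (λ x r → f x + r) 0# xs

  module _ {A : Set} where

    sumOver-cong : (xs : List A) {f g : A → Carrier} → (∀ x → f x ≈ g x) → sumOver xs f ≈ sumOver xs g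
    sumOver-cong []       f≈g = refl
    sumOver-cong (x ∷ xs) f≈g = +-cong (f≈g x) (sumOver-cong xs f≈g)

    sumOver-zero : (xs : List A) {f : A → Carrier} → (∀ x → f x ≈ 0#) → sumOver xs f ≈ 0#
    sumOver-zero []       f≈0 = refl
    sumOver-zero (x ∷ xs) f≈0 = trans (+-cong (f≈0 x) (sumOver-zero xs f≈0)) (+-identityˡ 0#)

    sumOver-++ : (xs ys : List A) (f : A → Carrier) → sumOver (xs ++ ys) f ≈ sumOver xs f + sumOver ys f
    sumOver-++ []       ys f = sym (+-identityˡ _)
    sumOver-++ (x ∷ xs) ys f = trans (+-congˡ (sumOver-++ xs ys f)) (sym (+-assoc (f x) _ _))

    sumOver-distrib-+ : (xs : List A) (f g : A → Carrier) →
                        sumOver xs (λ x → f x + g x) ≈ sumOver xs f + sumOver xs g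
    sumOver-distrib-+ []       f g = sym (+-identityˡ 0#)
    sumOver-distrib-+ (x ∷ xs) f g = begin
      (f x + g x) + sumOver xs (λ x → f x + g x) ≈⟨ +-congˡ (sumOver-distrib-+ xs f g) ⟩
      (f x + g x) + (sumOver xs f + sumOver xs g) ≈⟨ +-assoc (f x) (g x) _ ⟩
      f x + (g x + (sumOver xs f + sumOver xs g)) ≈⟨ +-congˡ (x∙yz≈y∙xz (g x) _ _) ⟩
      f x + (sumOver xs f + (g x + sumOver xs g)) ≈⟨ sym (+-assoc (f x) _ _) ⟩
      (f x + sumOver xs f) + (g x + sumOver xs g) ∎
      where open import Algebra.Properties.CommutativeSemigroup +-commutativeSemigroup using (x∙yz≈y∙xz)

    *-distribˡ-sumOver : (a : Carrier) (xs : List A) (f : A → Carrier) →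
                         a * sumOver xs f ≈ sumOver xs (λ x → a * f x)
    *-distribˡ-sumOver a []       f = zeroʳ a
    *-distribˡ-sumOver a (x ∷ xs) f = trans (distribˡ a (f x) _) (+-congˡ (*-distribˡ-sumOver a xs f))

    *-distribʳ-sumOver : (a : Carrier) (xs : List A) (f : A → Carrier) →
                         sumOver xs f * a ≈ sumOver xs (λ x → f x * a)
    *-distribʳ-sumOver a []       f = zeroˡ a
    *-distribʳ-sumOver a (x ∷ xs) f = trans (distribʳ a (f x) _) (+-congˡ (*-distribʳ-sumOver a xs f))

    sumOver-tabulate : ∀ {n} (g : Fin n → A) (f : A → Carrier) → sumOver (tabulate g) f ≡ sum (f ∘ g)
    sumOver-tabulate {zero}  g f = ≡.refl
    sumOver-tabulate {suc n} g f = ≡.cong (_+_ (f (g zero))) (sumOver-tabulate (g ∘ suc) f)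

  module _ {A B : Set} where

    sumOver-map : (g : A → B) (xs : List A) (f : B → Carrier) → sumOver (map g xs) f ≡ sumOver xs (f ∘ g)
    sumOver-map g []       f = ≡.refl
    sumOver-map g (x ∷ xs) f = ≡.cong (_+_ (f (g x))) (sumOver-map g xs f)

    sumOver-concatMap : (g : A → List B) (xs : List A) (f : B → Carrier) →
                        sumOver (concatMap g xs) f ≈ sumOver xs (λ x → sumOver (g x) f)
    sumOver-concatMap g []       f = refl
    sumOver-concatMap g (x ∷ xs) f =
      trans (sumOver-++ (g x) (concatMap g xs) f) (+-congˡ (sumOver-concatMap g xs f))

    sumOver-mapMaybe : (g : A → Maybe B) (xs : List A) (f : B → Carrier) →
                       sumOver (mapMaybe g xs) f ≈ sumOver xs (maybe′ f 0# ∘ g)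
    sumOver-mapMaybe g []       f = refl
    sumOver-mapMaybe g (x ∷ xs) f with g x
    ... | nothing = trans (sumOver-mapMaybe g xs f) (sym (+-identityˡ _))
    ... | just y  = +-congˡ (sumOver-mapMaybe g xs f)

    sumOver-comm : (xs : List A) (ys : List B) (f : A → B → Carrier) →
                   sumOver xs (λ x → sumOver ys (f x)) ≈ sumOver ys (λ y → sumOver xs (λ x → f x y))
    sumOver-comm []       ys f = sym (sumOver-zero ys (λ _ → refl))
    sumOver-comm (x ∷ xs) ys f = trans (+-congˡ (sumOver-comm xs ys f))
      (sym (sumOver-distrib-+ ys (f x) (λ y → sumOver xs (λ x → f x y))))

  sumOver-applyUpTo : ∀ {A : Set} (g : ℕ → A) n (f : A → Carrier) →
                      sumOver (applyUpTo g n) f ≡ sum {n} (λ j → f (g (toℕ j)))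
  sumOver-applyUpTo g zero    f = ≡.refl
  sumOver-applyUpTo g (suc n) f = ≡.cong (_+_ (f (g 0))) (sumOver-applyUpTo (g ∘ suc) n f)

  sum-pointMass : ∀ {n} (t : Fin n → Carrier) (i : Fin n) → (∀ j → j ≢ i → t j ≈ 0#) → sum t ≈ t i
  sum-pointMass {suc n} t i t≈0 = begin
    sum t                      ≈⟨ sum-remove t ⟩
    t i + sum (t ∘ punchIn i)  ≈⟨ +-congˡ (sum-cong-≋ (λ j → t≈0 _ (punchInᵢ≢i i j))) ⟩
    t i + sum {n} (λ _ → 0#)   ≈⟨ +-congˡ (sum-replicate-zero n) ⟩
    t i + 0#                   ≈⟨ +-identityʳ (t i) ⟩
    t i                        ∎

  sumOver-allVecs-pointMass : ∀ n m (h : Vec (Fin n) m → Carrier) (u : Vec (Fin n) m) →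
                              (∀ v → v ≢ u → h v ≈ 0#) → sumOver (allVecs n m) h ≈ h u
  sumOver-allVecs-pointMass n zero    h []       h≈0 = +-identityʳ (h [])
  sumOver-allVecs-pointMass n (suc m) h (u ∷ us) h≈0 = begin
    sumOver (concatMap (λ i → map (i ∷_) (allVecs n m)) (allFin n)) h
      ≈⟨ sumOver-concatMap (λ i → map (i ∷_) (allVecs n m)) (allFin n) h ⟩
    sumOver (allFin n) (λ i → sumOver (map (i ∷_) (allVecs n m)) h)
      ≈⟨ sumOver-cong (allFin n) (λ i → reflexive (sumOver-map (i ∷_) (allVecs n m) h)) ⟩
    sumOver (allFin n) (λ i → sumOver (allVecs n m) (h ∘ (i ∷_)))
      ≡⟨ sumOver-tabulate {n = n} id (λ i → sumOver (allVecs n m) (h ∘ (i ∷_))) ⟩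
    sum (λ i → sumOver (allVecs n m) (h ∘ (i ∷_)))
      ≈⟨ sum-pointMass _ u (λ i i≢u → sumOver-zero (allVecs n m) (λ v → h≈0 (i ∷ v) (i≢u ∘ ≡.cong Vec.head))) ⟩
    sumOver (allVecs n m) (h ∘ (u ∷_))
      ≈⟨ sumOver-allVecs-pointMass n m (h ∘ (u ∷_)) us (λ v v≢us → h≈0 (u ∷ v) (v≢us ∘ ≡.cong Vec.tail)) ⟩
    h (u ∷ us) ∎

  sumOver-allPerms : ∀ n (h : Perm n → Carrier) →
                     sumOver (allPerms n) h ≈
                     sumOver (allVecs n n) λ v₁ → sumOver (allVecs n n) λ v₂ → maybe′ h 0# (mkPerm (lookup v₁ , lookup v₂))
  sumOver-allPerms n h = begin
    sumOver (allPerms n) h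
      ≈⟨ sumOver-mapMaybe mkPerm (concatMap pairsWith (allFuns n)) h ⟩
    sumOver (concatMap pairsWith (allFuns n)) h′
      ≈⟨ sumOver-concatMap pairsWith (allFuns n) h′ ⟩
    sumOver (allFuns n) (λ f → sumOver (pairsWith f) h′)
      ≡⟨ sumOver-map lookup (allVecs n n) _ ⟩
    sumOver (allVecs n n) (λ v₁ → sumOver (pairsWith (lookup v₁)) h′)
      ≈⟨ sumOver-cong (allVecs n n) (λ v₁ → reflexive (≡.trans
           (sumOver-map (lookup v₁ ,_) (allFuns n) h′) (sumOver-map lookup (allVecs n n) _))) ⟩
    sumOver (allVecs n n) (λ v₁ → sumOver (allVecs n n) λ v₂ → h′ (lookup v₁ , lookup v₂)) ∎
    where
    pairsWith : (Fin n → Fin n) → List ((Fin n → Fin n) × (Fin n → Fin n))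
    pairsWith f = map (f ,_) (allFuns n)
    h′ : (Fin n → Fin n) × (Fin n → Fin n) → Carrier
    h′ = maybe′ h 0# ∘ mkPerm

  -- A permutation p is enumerated exactly once, as the pair of tabulations of p and p⁻¹.
  sumOver-allPerms-pointMass : ∀ n (h : Perm n → Carrier) (p : Perm n) {v : Carrier} →
                               (∀ σ → ¬ σ ≈ₚ p → h σ ≈ 0#) → (∀ σ → σ ≈ₚ p → h σ ≈ v) →
                               sumOver (allPerms n) h ≈ v
  sumOver-allPerms-pointMass n h p {v} h≈0 h≈v = begin
    sumOver (allPerms n) h                                       ≈⟨ sumOver-allPerms n h ⟩
    sumOver (allVecs n n) (λ v₁ → sumOver (allVecs n n) (T v₁))  ≈⟨ sumOver-allVecs-pointMass n n _ pᵛ T-off-pᵛ ⟩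
    sumOver (allVecs n n) (T pᵛ)                                 ≈⟨ sumOver-allVecs-pointMass n n _ p⁻¹ᵛ T-off-p⁻¹ᵛ ⟩
    T pᵛ p⁻¹ᵛ                                                    ≈⟨ T-at-p ⟩
    v                                                            ∎
    where
    pᵛ p⁻¹ᵛ : Vec (Fin n) n
    pᵛ   = Vec.tabulate (p ⟨$⟩ʳ_)
    p⁻¹ᵛ = Vec.tabulate (p ⟨$⟩ˡ_)

    T : Vec (Fin n) n → Vec (Fin n) n → Carrier
    T v₁ v₂ = maybe′ h 0# (mkPerm (lookup v₁ , lookup v₂))

    tabulate-lookup : ∀ (u : Vec (Fin n) n) {f} → lookup u ≗ f → u ≡ Vec.tabulate f
    tabulate-lookup u lookup≗f = ≡.trans (≡.sym (tabulate∘lookup u)) (tabulate-cong lookup≗f)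

    T≈0 : ∀ v₁ v₂ → ¬ (v₁ ≡ pᵛ × v₂ ≡ p⁻¹ᵛ) → T v₁ v₂ ≈ 0#
    T≈0 v₁ v₂ ≢p with mkPerm (lookup v₁ , lookup v₂) in eq
    ... | nothing = refl
    ... | just σ  = h≈0 σ λ σ≈p → ≢p
      ( tabulate-lookup v₁ (λ x → ≡.trans (≡.sym (proj₁ σ≗v x)) (σ≈p x))
      , tabulate-lookup v₂ (λ y → ≡.trans (≡.sym (proj₂ σ≗v y)) (flip-cong σ p σ≈p y)))
      where σ≗v = mkPerm-sound (lookup v₁) (lookup v₂) σ eq

    T-off-pᵛ : ∀ v₁ → v₁ ≢ pᵛ → sumOver (allVecs n n) (T v₁) ≈ 0#
    T-off-pᵛ v₁ v₁≢pᵛ = sumOver-zero (allVecs n n) (λ v₂ → T≈0 v₁ v₂ (v₁≢pᵛ ∘ proj₁))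

    T-off-p⁻¹ᵛ : ∀ v₂ → v₂ ≢ p⁻¹ᵛ → T pᵛ v₂ ≈ 0#
    T-off-p⁻¹ᵛ v₂ v₂≢p⁻¹ᵛ = T≈0 pᵛ v₂ (v₂≢p⁻¹ᵛ ∘ proj₂)

    lookup-pᵛ : lookup pᵛ ≗ (p ⟨$⟩ʳ_)
    lookup-pᵛ = lookup∘tabulate (p ⟨$⟩ʳ_)

    lookup-p⁻¹ᵛ : lookup p⁻¹ᵛ ≗ (p ⟨$⟩ˡ_)
    lookup-p⁻¹ᵛ = lookup∘tabulate (p ⟨$⟩ˡ_)

    T-at-p : T pᵛ p⁻¹ᵛ ≈ v
    T-at-p with mkPerm-complete (lookup pᵛ) (lookup p⁻¹ᵛ)
      (λ y → ≡.trans (≡.cong (lookup pᵛ) (lookup-p⁻¹ᵛ y)) (≡.trans (lookup-pᵛ _) (inverseʳ p)))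
      (λ x → ≡.trans (≡.cong (lookup p⁻¹ᵛ) (lookup-pᵛ x)) (≡.trans (lookup-p⁻¹ᵛ _) (inverseˡ p)))
    ... | σ , eq rewrite eq =
      h≈v σ (λ x → ≡.trans (proj₁ (mkPerm-sound (lookup pᵛ) (lookup p⁻¹ᵛ) σ eq) x) (lookup-pᵛ x))

module Rotations where

  open import Data.Fin using (zero; suc)
  open import Data.Fin.Properties using (toℕ-inject₁)
  open import Relation.Binary.PropositionalEquality using (refl; sym; trans)
  open ℕΣ using (sum-syntax; sum-cong-≗; sum-permute)

  module _ {m : ℕ} where

    zeta⁻¹ : Fin (suc m) → Fin (suc m)
    zeta⁻¹ zero    = fromℕ m
    zeta⁻¹ (suc j) = inject₁ j

  zeta-inject₁ : ∀ {m} (j : Fin m) → zeta (inject₁ j) ≡ suc j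
  zeta-inject₁ {suc m} zero    = refl
  zeta-inject₁ {suc m} (suc j) rewrite zeta-inject₁ j = refl

  zeta-fromℕ : ∀ m → zeta (fromℕ m) ≡ zero
  zeta-fromℕ zero    = refl
  zeta-fromℕ (suc m) rewrite zeta-fromℕ m = refl

  zeta-zeta⁻¹ : ∀ {m} (y : Fin (suc m)) → zeta (zeta⁻¹ y) ≡ y
  zeta-zeta⁻¹ {m} zero = zeta-fromℕ m
  zeta-zeta⁻¹ (suc j)  = zeta-inject₁ j

  zeta⁻¹-zeta : ∀ {m} (x : Fin (suc m)) → zeta⁻¹ (zeta x) ≡ x
  zeta⁻¹-zeta {zero}  zero    = refl
  zeta⁻¹-zeta {suc m} zero    = refl
  zeta⁻¹-zeta {suc m} (suc x) with zeta x | zeta⁻¹-zeta x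
  ... | zero  | eq = cong suc eq
  ... | suc _ | eq = cong suc eq

  zetaPow⁻¹ : ∀ {m} → ℕ → Fin (suc m) → Fin (suc m)
  zetaPow⁻¹ zero    y = y
  zetaPow⁻¹ (suc i) y = zetaPow⁻¹ i (zeta⁻¹ y)

  zetaPow-zeta : ∀ {m} i (x : Fin (suc m)) → zetaPow i (zeta x) ≡ zeta (zetaPow i x)
  zetaPow-zeta zero    x = refl
  zetaPow-zeta (suc i) x = cong zeta (zetaPow-zeta i x)

  zetaPow-zetaPow⁻¹ : ∀ {m} i (y : Fin (suc m)) → zetaPow i (zetaPow⁻¹ i y) ≡ y
  zetaPow-zetaPow⁻¹ zero    y = refl
  zetaPow-zetaPow⁻¹ (suc i) y = trans (cong zeta (zetaPow-zetaPow⁻¹ i (zeta⁻¹ y))) (zeta-zeta⁻¹ y)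

  zetaPow⁻¹-zetaPow : ∀ {m} i (x : Fin (suc m)) → zetaPow⁻¹ i (zetaPow i x) ≡ x
  zetaPow⁻¹-zetaPow zero    x = refl
  zetaPow⁻¹-zetaPow (suc i) x = trans (cong (zetaPow⁻¹ i) (zeta⁻¹-zeta (zetaPow i x))) (zetaPow⁻¹-zetaPow i x)

  zetaPerm : ∀ {m} → ℕ → Perm (suc m)
  zetaPerm i = permutation (zetaPow i) (zetaPow⁻¹ i) (zetaPow-zetaPow⁻¹ i) (zetaPow⁻¹-zetaPow i)

  zetaPow-fromℕ : ∀ {m} t (j : Fin (suc m)) → toℕ j ≡ t → zetaPow t (fromℕ m) ≡ zeta⁻¹ j
  zetaPow-fromℕ zero    zero    _ = refl
  zetaPow-fromℕ (suc t) (suc j) j≡1+t = begin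
    zeta (zetaPow t (fromℕ _))  ≡⟨ cong zeta (zetaPow-fromℕ t (inject₁ j) (trans (toℕ-inject₁ j) (ℕP.suc-injective j≡1+t))) ⟩
    zeta (zeta⁻¹ (inject₁ j))   ≡⟨ zeta-zeta⁻¹ (inject₁ j) ⟩
    inject₁ j                   ∎
    where open ≡.≡-Reasoning

  ∑-zetaPow : ∀ {m} i (h : Fin (suc m) → ℕ) → ∑[ p < suc m ] h (zetaPow i p) ≡ ∑[ p < suc m ] h p
  ∑-zetaPow i h = sym (sum-permute h (zetaPerm i))

  ∑-orbit-fromℕ : ∀ {m} (h : Fin (suc m) → ℕ) → ∑[ j < suc m ] h (zetaPow (toℕ j) (fromℕ m)) ≡ ∑[ p < suc m ] h p
  ∑-orbit-fromℕ h = trans (sum-cong-≗ (λ j → cong h (zetaPow-fromℕ (toℕ j) j refl)))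
                          (sym (sum-permute h (Perm.flip (zetaPerm 1))))

open Rotations

module Binomials where

  open import Data.Nat using (_+_; _*_; _≤_; _≤?_; s≤s)
  open ℕP
    using (*-zeroʳ; *-identityˡ; *-identityʳ; *-distribˡ-+; *-distribʳ-+; +-comm
          ; m+n∸m≡n; m+[n∸m]≡n; [m+n]∸[m+o]≡n∸o; +-∸-assoc; m≤n⇒m∸n≡0; ≰⇒>; m≤n⇒∃[o]m+o≡n)
  open import Data.Nat.Combinatorics using (nC1≡n; nCk+nC[k+1]≡[n+1]C[k+1])
  open import Data.Nat.Combinatorics.Specification using (k>n⇒nCk≡0)
  open import Data.Nat.Tactic.RingSolver using (solve-∀)
  open import Relation.Binary.PropositionalEquality using (refl; cong₂; sym; trans)

  [1+k]*nC[1+k]≡[n∸k]*nCk : ∀ n k → suc k * (n C suc k) ≡ (n ∸ k) * (n C k)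
  [1+k]*nC[1+k]≡[n∸k]*nCk zero    zero    = refl
  [1+k]*nC[1+k]≡[n∸k]*nCk zero    (suc k) = *-zeroʳ (suc (suc k))
  [1+k]*nC[1+k]≡[n∸k]*nCk (suc n) zero    =
    trans (*-identityˡ _) (trans (nC1≡n (suc n)) (sym (*-identityʳ (suc n))))
  [1+k]*nC[1+k]≡[n∸k]*nCk (suc n) (suc k) with suc k ≤? n
  ... | yes k<n = begin
    suc (suc k) * (suc n C suc (suc k))             ≡⟨ cong (suc (suc k) *_) (nCk+nC[k+1]≡[n+1]C[k+1] n (suc k)) ⟨
    suc (suc k) * (X + n C suc (suc k))             ≡⟨ *-distribˡ-+ (suc (suc k)) X _ ⟩
    suc (suc k) * X + suc (suc k) * (n C suc (suc k)) ≡⟨ cong (_+_ (suc (suc k) * X)) ([1+k]*nC[1+k]≡[n∸k]*nCk n (suc k)) ⟩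
    suc (suc k) * X + (n ∸ suc k) * X               ≡⟨ regroup k X (n ∸ suc k) ⟩
    suc k * X + suc (n ∸ suc k) * X                 ≡⟨ cong (λ d → suc k * X + d * X) (+-∸-assoc 1 k<n) ⟨
    suc k * X + (n ∸ k) * X                         ≡⟨ cong (_+ (n ∸ k) * X) ([1+k]*nC[1+k]≡[n∸k]*nCk n k) ⟩
    (n ∸ k) * (n C k) + (n ∸ k) * X                 ≡⟨ *-distribˡ-+ (n ∸ k) _ X ⟨
    (n ∸ k) * (n C k + X)                           ≡⟨ cong ((n ∸ k) *_) (nCk+nC[k+1]≡[n+1]C[k+1] n k) ⟩
    (n ∸ k) * (suc n C suc k)                       ∎
    where
    open ≡.≡-Reasoning
    X = n C suc k
    regroup : ∀ k X d → suc (suc k) * X + d * X ≡ suc k * X + suc d * X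
    regroup = solve-∀
  ... | no k≮n = begin
    suc (suc k) * (suc n C suc (suc k)) ≡⟨ cong (suc (suc k) *_) (k>n⇒nCk≡0 (s≤s (≰⇒> k≮n))) ⟩
    suc (suc k) * 0                     ≡⟨ *-zeroʳ (suc (suc k)) ⟩
    0                                   ≡⟨ cong (_* (suc n C suc k)) (m≤n⇒m∸n≡0 (ℕP.≤-pred (≰⇒> k≮n))) ⟨
    (n ∸ k) * (suc n C suc k)           ∎
    where open ≡.≡-Reasoning

  pascal-absorption : ∀ c t m M → c + t ≡ suc m →
                      c * (suc M C suc m) + t * (M C suc m) ≡ (c + (M ∸ m)) * (M C m)
  pascal-absorption c t m M c+t≡1+m = begin
    c * (suc M C suc m) + t * Y  ≡⟨ cong (λ z → c * z + t * Y) (nCk+nC[k+1]≡[n+1]C[k+1] M m) ⟨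
    c * (X + Y) + t * Y          ≡⟨ regroup c t X Y ⟩
    c * X + (c + t) * Y          ≡⟨ cong (λ z → c * X + z * Y) c+t≡1+m ⟩
    c * X + suc m * Y            ≡⟨ cong (_+_ (c * X)) ([1+k]*nC[1+k]≡[n∸k]*nCk M m) ⟩
    c * X + (M ∸ m) * X          ≡⟨ *-distribʳ-+ X c (M ∸ m) ⟨
    (c + (M ∸ m)) * X            ∎
    where
    open ≡.≡-Reasoning
    X = M C m
    Y = M C suc m
    regroup : ∀ c t X Y → c * (X + Y) + t * Y ≡ c * X + (c + t) * Y
    regroup = solve-∀

  [1+c+[r+k∸[c+r]]]*[r+k]C[c+r]≡[1+k]*[r+k]C[c+r] : ∀ c r k →
    (suc c + (r + k ∸ (c + r))) * ((r + k) C (c + r)) ≡ suc k * ((r + k) C (c + r))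
  [1+c+[r+k∸[c+r]]]*[r+k]C[c+r]≡[1+k]*[r+k]C[c+r] c r k with c ≤? k
  ... | yes c≤k = cong (λ z → z * ((r + k) C (c + r))) (begin
    suc c + (r + k ∸ (c + r))  ≡⟨ cong (λ z → suc c + (r + k ∸ z)) (+-comm c r) ⟩
    suc c + (r + k ∸ (r + c))  ≡⟨ cong (λ z → suc c + z) ([m+n]∸[m+o]≡n∸o r k c) ⟩
    suc (c + (k ∸ c))          ≡⟨ cong suc (m+[n∸m]≡n c≤k) ⟩
    suc k                      ∎)
    where open ≡.≡-Reasoning
  ... | no c≰k = begin
    (suc c + (r + k ∸ (c + r))) * ((r + k) C (c + r)) ≡⟨ cong ((suc c + (r + k ∸ (c + r))) *_) r+kC[c+r]≡0 ⟩
    (suc c + (r + k ∸ (c + r))) * 0                   ≡⟨ *-zeroʳ (suc c + (r + k ∸ (c + r))) ⟩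
    0                                                 ≡⟨ *-zeroʳ (suc k) ⟨
    suc k * 0                                         ≡⟨ cong (suc k *_) r+kC[c+r]≡0 ⟨
    suc k * ((r + k) C (c + r))                       ∎
    where
    open ≡.≡-Reasoning
    r+kC[c+r]≡0 : (r + k) C (c + r) ≡ 0
    r+kC[c+r]≡0 = k>n⇒nCk≡0 (ℕP.≤-trans (ℕP.≤-reflexive (cong suc (+-comm r k))) (ℕP.+-monoˡ-≤ r (≰⇒> c≰k)))

  descent-binomial-identity : ∀ m k c → c ≤ suc m →
    c * ((suc m + suc k ∸ (c ∸ 1) ∸ 1) C suc m) + (suc m ∸ c) * ((suc m + suc k ∸ c ∸ 1) C suc m)
      ≡ suc k * ((suc m + suc k ∸ c ∸ 1) C m)
  descent-binomial-identity m k zero _ = begin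
    suc m * ((m + suc k) C suc m)      ≡⟨ [1+k]*nC[1+k]≡[n∸k]*nCk (m + suc k) m ⟩
    (m + suc k ∸ m) * ((m + suc k) C m) ≡⟨ cong (_* ((m + suc k) C m)) (m+n∸m≡n m (suc k)) ⟩
    suc k * ((m + suc k) C m)          ∎
    where open ≡.≡-Reasoning
  descent-binomial-identity m k (suc c) (s≤s c≤m) with m≤n⇒∃[o]m+o≡n c≤m
  ... | r , refl = begin
    suc c * ((suc (c + r + suc k) ∸ c ∸ 1) C suc (c + r)) + (c + r ∸ c) * ((c + r + suc k ∸ c ∸ 1) C suc (c + r))
      ≡⟨ cong₂ (λ a b → suc c * (a C suc (c + r)) + b) top₁ (cong₂ (λ a b → a * (b C suc (c + r))) (m+n∸m≡n c r) top₂) ⟩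
    suc c * (suc (r + k) C suc (c + r)) + r * ((r + k) C suc (c + r))
      ≡⟨ pascal-absorption (suc c) r (c + r) (r + k) refl ⟩
    (suc c + (r + k ∸ (c + r))) * ((r + k) C (c + r))
      ≡⟨ [1+c+[r+k∸[c+r]]]*[r+k]C[c+r]≡[1+k]*[r+k]C[c+r] c r k ⟩
    suc k * ((r + k) C (c + r))
      ≡⟨ cong (λ b → suc k * (b C (c + r))) top₂ ⟨
    suc k * ((c + r + suc k ∸ c ∸ 1) C (c + r)) ∎
    where
    open ≡.≡-Reasoning
    reassoc : ∀ c r k → c + r + suc k ≡ c + suc (r + k)
    reassoc = solve-∀
    reassoc′ : ∀ c r k → suc (c + r + suc k) ≡ c + suc (suc (r + k))
    reassoc′ = solve-∀
    top₂ : c + r + suc k ∸ c ∸ 1 ≡ r + k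
    top₂ = cong (_∸ 1) (trans (cong (_∸ c) (reassoc c r k)) (m+n∸m≡n c (suc (r + k))))
    top₁ : suc (c + r + suc k) ∸ c ∸ 1 ≡ suc (r + k)
    top₁ = cong (_∸ 1) (trans (cong (_∸ c) (reassoc′ c r k)) (m+n∸m≡n c (suc (suc (r + k)))))

open Binomials

module CyclicDescents where

  open import Data.Fin using (zero; suc)
  open import Data.List using (filter; length; tabulate; allFin)
  open import Data.List.Properties using (length-filter; length-tabulate)
  open import Data.Nat using (_+_; _*_; _≤_; z≤n; s≤s)
  open ℕP using (≤-trans; ≤-reflexive; m+n∸n≡m; m+n∸m≡n; +-identityʳ; *-identityˡ)
  open import Relation.Binary.PropositionalEquality using (refl; cong₂; sym; trans)
  open import Relation.Unary using (Pred)
  open ℕΣ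
    using (sum-syntax; sum-cong-≗; sum-init-last; ∑-distrib-+; *-distribʳ-sum)

  indicator : Bool → ℕ
  indicator b = if b then 1 else 0

  length-filter-tabulate : ∀ {a p} {A : Set a} {n} {P : Pred A p} (P? : ∀ x → Dec (P x)) (g : Fin n → A) →
                           length (filter P? (tabulate g)) ≡ ∑[ j < n ] indicator (does (P? (g j)))
  length-filter-tabulate {n = zero}  P? g = refl
  length-filter-tabulate {n = suc n} P? g with does (P? (g zero))
  ... | true  = cong suc (length-filter-tabulate P? (g ∘ suc))
  ... | false = length-filter-tabulate P? (g ∘ suc)

  module _ {m : ℕ} (f : Fin (suc m) → Fin (suc m)) where

    hasCyclicDescentAt : Fin (suc m) → Bool
    hasCyclicDescentAt p = does (f (zeta p) <? f p)

    des≡∑ : des f ≡ ∑[ j < m ] indicator (hasCyclicDescentAt (inject₁ j))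
    des≡∑ = trans (length-filter-tabulate (λ i → f (suc i) <? f (inject₁ i)) id)
                  (sum-cong-≗ λ j → cong (λ x → indicator (does (f x <? f (inject₁ j)))) (sym (zeta-inject₁ j)))

    cdes≡des+last : cdes f ≡ des f + indicator (hasCyclicDescentAt (fromℕ m))
    cdes≡des+last = cong (λ x → des f + indicator (does (f x <? f (fromℕ m)))) (sym (zeta-fromℕ m))

    cdes≡∑ : cdes f ≡ ∑[ p < suc m ] indicator (hasCyclicDescentAt p)
    cdes≡∑ = trans cdes≡des+last (trans (cong (_+ indicator (hasCyclicDescentAt (fromℕ m))) des≡∑)
                                        (sym (sum-init-last {m} (indicator ∘ hasCyclicDescentAt))))

    cdes≤1+m : cdes f ≤ suc m
    cdes≤1+m = begin
      cdes f                                               ≡⟨ cdes≡des+last ⟩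
      des f + indicator (hasCyclicDescentAt (fromℕ m))     ≤⟨ ℕP.+-mono-≤ des≤m (indicator≤1 _) ⟩
      m + 1                                                ≡⟨ ℕP.+-comm m 1 ⟩
      suc m                                                ∎
      where
      open ℕP.≤-Reasoning
      des≤m : des f ≤ m
      des≤m = ≤-trans (length-filter _ (allFin m)) (≤-reflexive (length-tabulate id))
      indicator≤1 : ∀ b → indicator b ≤ 1
      indicator≤1 true  = s≤s z≤n
      indicator≤1 false = z≤n

  hasCyclicDescentAt-∘zetaPow : ∀ {m} (f : Fin (suc m) → Fin (suc m)) i p →
                                hasCyclicDescentAt (f ∘ zetaPow i) p ≡ hasCyclicDescentAt f (zetaPow i p)
  hasCyclicDescentAt-∘zetaPow f i p = cong (λ x → does (f x <? f (zetaPow i p))) (zetaPow-zeta i p)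

  cdes-∘zetaPow : ∀ {m} (f : Fin (suc m) → Fin (suc m)) i → cdes (f ∘ zetaPow i) ≡ cdes f
  cdes-∘zetaPow {m} f i = begin
    cdes (f ∘ zetaPow i)                                          ≡⟨ cdes≡∑ (f ∘ zetaPow i) ⟩
    ∑[ p < suc m ] indicator (hasCyclicDescentAt (f ∘ zetaPow i) p)  ≡⟨ sum-cong-≗ (cong indicator ∘ hasCyclicDescentAt-∘zetaPow f i) ⟩
    ∑[ p < suc m ] indicator (hasCyclicDescentAt f (zetaPow i p))    ≡⟨ ∑-zetaPow i (indicator ∘ hasCyclicDescentAt f) ⟩
    ∑[ p < suc m ] indicator (hasCyclicDescentAt f p)                ≡⟨ cdes≡∑ f ⟨
    cdes f                                                        ∎
    where open ≡.≡-Reasoning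

  des-∘zetaPow : ∀ {m} (f : Fin (suc m) → Fin (suc m)) i →
                 des (f ∘ zetaPow i) + indicator (hasCyclicDescentAt f (zetaPow i (fromℕ m))) ≡ cdes f
  des-∘zetaPow {m} f i = begin
    des (f ∘ zetaPow i) + indicator (hasCyclicDescentAt f (zetaPow i (fromℕ m)))
      ≡⟨ cong (λ b → des (f ∘ zetaPow i) + indicator b) (hasCyclicDescentAt-∘zetaPow f i (fromℕ m)) ⟨
    des (f ∘ zetaPow i) + indicator (hasCyclicDescentAt (f ∘ zetaPow i) (fromℕ m))
      ≡⟨ cdes≡des+last (f ∘ zetaPow i) ⟨
    cdes (f ∘ zetaPow i)
      ≡⟨ cdes-∘zetaPow f i ⟩
    cdes f ∎
    where open ≡.≡-Reasoning

  des-cong : ∀ {m} {f g : Fin (suc m) → Fin (suc m)} → f ≗ g → des f ≡ des g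
  des-cong {m} {f} {g} f≗g = trans (des≡∑ f) (trans
    (sum-cong-≗ {m} λ j → cong₂ (λ x y → indicator (does (x <? y))) (f≗g _) (f≗g _)) (sym (des≡∑ g)))

  ∑[j<n]1≡n : ∀ n → ∑[ j < n ] 1 ≡ n
  ∑[j<n]1≡n zero    = refl
  ∑[j<n]1≡n (suc n) = cong suc (∑[j<n]1≡n n)

  ∑-indicator+∑-indicator-not : ∀ {n} (b : Fin n → Bool) →
                                ∑[ j < n ] indicator (b j) + ∑[ j < n ] indicator (not (b j)) ≡ n
  ∑-indicator+∑-indicator-not {n} b = trans (sym (∑-distrib-+ (indicator ∘ b) (indicator ∘ not ∘ b)))
    (trans (sum-cong-≗ (indicator+indicator-not ∘ b)) (∑[j<n]1≡n n))
    where
    indicator+indicator-not : ∀ b → indicator b + indicator (not b) ≡ 1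
    indicator+indicator-not true  = refl
    indicator+indicator-not false = refl

  C-at-indicator : ∀ N n c (b : Bool) →
                   (N ∸ (c ∸ indicator b) ∸ 1) C n ≡ indicator b * ((N ∸ (c ∸ 1) ∸ 1) C n) + indicator (not b) * ((N ∸ c ∸ 1) C n)
  C-at-indicator N n c true  = sym (trans (+-identityʳ _) (*-identityˡ _))
  C-at-indicator N n c false = sym (+-identityʳ _)

  ∑-binomial-rotations : ∀ m k (u : Fin (suc m) → Fin (suc m)) →
    ∑[ j < suc m ] ((suc m + suc k ∸ des (u ∘ zetaPow (toℕ j)) ∸ 1) C suc m) ≡ suc k * ((suc m + suc k ∸ cdes u ∸ 1) C m)
  ∑-binomial-rotations m k u = begin
    ∑[ j < n ] ((N ∸ des (u ∘ zetaPow (toℕ j)) ∸ 1) C n)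
      ≡⟨ sum-cong-≗ (λ j → trans (cong (λ d → (N ∸ d ∸ 1) C n) (des≡c∸ (toℕ j))) (C-at-indicator N n c (b j))) ⟩
    ∑[ j < n ] (indicator (b j) * A + indicator (not (b j)) * B)
      ≡⟨ ∑-distrib-+ (λ j → indicator (b j) * A) (λ j → indicator (not (b j)) * B) ⟩
    ∑[ j < n ] (indicator (b j) * A) + ∑[ j < n ] (indicator (not (b j)) * B)
      ≡⟨ cong₂ _+_ (*-distribʳ-sum A (indicator ∘ b)) (*-distribʳ-sum B (indicator ∘ not ∘ b)) ⟨
    ∑[ j < n ] indicator (b j) * A + ∑[ j < n ] indicator (not (b j)) * B
      ≡⟨ cong₂ (λ x y → x * A + y * B) ∑b≡c ∑notb≡n∸c ⟩
    c * A + (n ∸ c) * B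
      ≡⟨ descent-binomial-identity m k c (cdes≤1+m u) ⟩
    suc k * ((N ∸ c ∸ 1) C m) ∎
    where
    open ≡.≡-Reasoning
    n = suc m
    N = n + suc k
    c = cdes u
    A = (N ∸ (c ∸ 1) ∸ 1) C n
    B = (N ∸ c ∸ 1) C n
    b : Fin n → Bool
    b j = hasCyclicDescentAt u (zetaPow (toℕ j) (fromℕ m))
    des≡c∸ : ∀ i → des (u ∘ zetaPow i) ≡ c ∸ indicator (hasCyclicDescentAt u (zetaPow i (fromℕ m)))
    des≡c∸ i = trans (sym (m+n∸n≡m (des (u ∘ zetaPow i)) δ)) (cong (_∸ δ) (des-∘zetaPow u i))
      where δ = indicator (hasCyclicDescentAt u (zetaPow i (fromℕ m)))
    ∑b≡c : ∑[ j < n ] indicator (b j) ≡ c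
    ∑b≡c = trans (∑-orbit-fromℕ (indicator ∘ hasCyclicDescentAt u)) (sym (cdes≡∑ u))
    ∑notb≡n∸c : ∑[ j < n ] indicator (not (b j)) ≡ n ∸ c
    ∑notb≡n∸c = trans (sym (m+n∸m≡n (∑[ j < n ] indicator (b j)) _))
                      (cong₂ _∸_ (∑-indicator+∑-indicator-not b) ∑b≡c)

open CyclicDescents

module Fractions where

  open import Data.Fin using (zero; suc)
  open import Data.Integer as ℤ using (ℤ)
  open import Data.Integer.Properties using (pos-*)
  open import Data.Integer.Tactic.RingSolver using (solve-∀)
  open import Data.Nat using (_*_; pred)
  open import Data.Rational using (toℚᵘ)
  open import Data.Rational.Properties as ℚP using (toℚᵘ-injective; toℚᵘ-fromℚᵘ; toℚᵘ-homo-+; toℚᵘ-homo-*; 0/n≡0)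
  open import Data.Rational.Unnormalised using (mkℚᵘ; *≡*) renaming (_≃_ to _≃ᵘ_)
  open import Data.Rational.Unnormalised.Properties as ℚᵘP using (≃-trans; ≃-sym)
  open import Relation.Binary.PropositionalEquality using (cong₂; sym)
  open ℕΣ using (sum-syntax)

  toℚᵘ-/ : ∀ i n .{{_ : NonZero n}} → toℚᵘ (i / n) ≃ᵘ mkℚᵘ i (pred n)
  toℚᵘ-/ i (suc n) = toℚᵘ-fromℚᵘ (mkℚᵘ i n)

  i/n+j/n≡[i+j]/n : ∀ i j n .{{_ : NonZero n}} → i / n ℚ.+ j / n ≡ (i ℤ.+ j) / n
  i/n+j/n≡[i+j]/n i j n@(suc _) = toℚᵘ-injective (≃-trans (toℚᵘ-homo-+ (i / n) (j / n))
    (≃-trans (ℚᵘP.+-cong (toℚᵘ-/ i n) (toℚᵘ-/ j n)) (≃-trans (*≡* cross) (≃-sym (toℚᵘ-/ (i ℤ.+ j) n)))))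
    where
    cross : (i ℤ.* + n ℤ.+ j ℤ.* + n) ℤ.* + n ≡ (i ℤ.+ j) ℤ.* + (n * n)
    cross = ≡.trans (eq i j (+ n)) (cong ((i ℤ.+ j) ℤ.*_) (sym (pos-* n n)))
      where
      eq : ∀ i j q → (i ℤ.* q ℤ.+ j ℤ.* q) ℤ.* q ≡ (i ℤ.+ j) ℤ.* (q ℤ.* q)
      eq = solve-∀

  ∑[a/q]≡[∑a]/q : ∀ n (a : Fin n → ℕ) q .{{_ : NonZero q}} → ℚΣ.sum (λ j → + a j / q) ≡ + (∑[ j < n ] a j) / q
  ∑[a/q]≡[∑a]/q zero    a q = sym (0/n≡0 q)
  ∑[a/q]≡[∑a]/q (suc n) a q = ≡.trans (cong (+ a zero / q ℚ.+_) (∑[a/q]≡[∑a]/q n (a ∘ suc) q))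
                                      (i/n+j/n≡[i+j]/n (+ a zero) (+ (∑[ j < n ] a (suc j))) q)

  1/n*[k*a]/[k*p]≡a/[n*p] : ∀ n k a p .{{_ : NonZero n}} .{{_ : NonZero k}} .{{_ : NonZero p}} →
    (+ 1 / n) ℚ.* _/_ (+ (k * a)) (k * p) {{m*n≢0 k p}} ≡ _/_ (+ a) (n * p) {{m*n≢0 n p}}
  1/n*[k*a]/[k*p]≡a/[n*p] n@(suc _) k@(suc _) a p@(suc _) = toℚᵘ-injective (≃-trans (toℚᵘ-homo-* (+ 1 / n) (+ (k * a) / (k * p)))
    (≃-trans (ℚᵘP.*-cong (toℚᵘ-/ (+ 1) n) (toℚᵘ-/ (+ (k * a)) (k * p))) (≃-trans (*≡* cross) (≃-sym (toℚᵘ-/ (+ a) (n * p))))))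
    where
    cross : (+ 1 ℤ.* + (k * a)) ℤ.* + (n * p) ≡ + a ℤ.* + (n * (k * p))
    cross = ≡.trans (cong₂ (λ x y → (+ 1 ℤ.* x) ℤ.* y) (pos-* k a) (pos-* n p))
            (≡.trans (eq (+ k) (+ a) (+ n) (+ p))
            (cong (+ a ℤ.*_) (≡.trans (cong (+ n ℤ.*_) (sym (pos-* k p))) (sym (pos-* n (k * p))))))
      where
      eq : ∀ k a n p → (+ 1 ℤ.* (k ℤ.* a)) ℤ.* (n ℤ.* p) ≡ a ℤ.* (n ℤ.* (k ℤ.* p))
      eq = solve-∀

open Fractions

module ℚListSum = ListSum (CommutativeRing.commutativeSemiring ℚP.+-*-commutativeRing)

module GroupAlgebra where

  open import Relation.Binary.PropositionalEquality using (refl; sym; trans)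
  open import Relation.Nullary.Decidable using (dec-true; dec-false)
  open ℚListSum

  Extensional : ∀ {n} → QS n → Set
  Extensional y = ∀ σ τ → σ ≈ₚ τ → y σ ≡ y τ

  ·-coefficient : ∀ {n} (x y : QS n) → Extensional y → ∀ w →
                  (x · y) w ≡ sumOver (allPerms n) (λ σ → x σ ℚ.* y (w ∘ₚ Perm.flip σ))
  ·-coefficient {n} x y y-ext w = sumOver-cong (allPerms n) λ σ →
    sumOver-allPerms-pointMass n (term σ) (w ∘ₚ Perm.flip σ) (term-off σ) (term-at σ)
    where
    composesTo? : ∀ σ τ → Dec (∀ i → σ ⟨$⟩ʳ (τ ⟨$⟩ʳ i) ≡ w ⟨$⟩ʳ i)
    composesTo? σ τ = all? (λ i → (σ ⟨$⟩ʳ (τ ⟨$⟩ʳ i)) ≟ (w ⟨$⟩ʳ i))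

    term : Perm n → Perm n → ℚ
    term σ τ = if does (composesTo? σ τ) then x σ ℚ.* y τ else 0ℚ

    term-off : ∀ σ τ → ¬ τ ≈ₚ w ∘ₚ Perm.flip σ → term σ τ ≡ 0ℚ
    term-off σ τ τ≉p = cong (if_then x σ ℚ.* y τ else 0ℚ) (dec-false (composesTo? σ τ) λ στ≈w →
      τ≉p λ i → trans (sym (inverseˡ σ)) (cong (σ ⟨$⟩ˡ_) (στ≈w i)))

    term-at : ∀ σ τ → τ ≈ₚ w ∘ₚ Perm.flip σ → term σ τ ≡ x σ ℚ.* y (w ∘ₚ Perm.flip σ)
    term-at σ τ τ≈p = trans
      (cong (if_then x σ ℚ.* y τ else 0ℚ) (dec-true (composesTo? σ τ) λ i →
        trans (cong (σ ⟨$⟩ʳ_) (τ≈p i)) (inverseʳ σ)))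
      (cong (x σ ℚ.*_) (y-ext τ (w ∘ₚ Perm.flip σ) τ≈p))

  cut-·-coefficient : ∀ m (y : QS (suc m)) → Extensional y → ∀ w →
                      (cut m · y) w ≡ (+ 1 / suc m) ℚ.* sumOver (upTo (suc m)) (λ i → y (w ∘ₚ Perm.flip (zetaPerm i)))
  cut-·-coefficient m y y-ext w = begin
    (cut m · y) w
      ≡⟨ ·-coefficient (cut m) y y-ext w ⟩
    sumOver (allPerms n) (λ σ → cut m σ ℚ.* Y σ)
      ≡⟨ sumOver-cong (allPerms n) (λ σ → *-distribʳ-sumOver (Y σ) (upTo n) (term σ)) ⟩
    sumOver (allPerms n) (λ σ → sumOver (upTo n) (λ i → term σ i ℚ.* Y σ))
      ≡⟨ sumOver-comm (allPerms n) (upTo n) (λ σ i → term σ i ℚ.* Y σ) ⟩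
    sumOver (upTo n) (λ i → sumOver (allPerms n) (λ σ → term σ i ℚ.* Y σ))
      ≡⟨ sumOver-cong (upTo n) (λ i → sumOver-allPerms-pointMass n _ (zetaPerm i) (term-off i) (term-at i)) ⟩
    sumOver (upTo n) (λ i → 1/n ℚ.* Y (zetaPerm i))
      ≡⟨ *-distribˡ-sumOver 1/n (upTo n) (Y ∘ zetaPerm) ⟨
    1/n ℚ.* sumOver (upTo n) (λ i → Y (zetaPerm i)) ∎
    where
    open ≡.≡-Reasoning
    n : ℕ
    n = suc m
    1/n : ℚ
    1/n = + 1 / n

    Y : Perm n → ℚ
    Y σ = y (w ∘ₚ Perm.flip σ)

    isZetaPow? : ∀ σ i → Dec (∀ x → zetaPow i x ≡ σ ⟨$⟩ʳ x)
    isZetaPow? σ i = all? (λ x → zetaPow i x ≟ (σ ⟨$⟩ʳ x))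

    term : Perm n → ℕ → ℚ
    term σ i = if does (isZetaPow? σ i) then 1/n else 0ℚ

    term-off : ∀ i σ → ¬ σ ≈ₚ zetaPerm i → term σ i ℚ.* Y σ ≡ 0ℚ
    term-off i σ σ≉ζⁱ = trans (cong (λ b → (if b then 1/n else 0ℚ) ℚ.* Y σ) (dec-false (isZetaPow? σ i) (σ≉ζⁱ ∘ (sym ∘_))))
                              (ℚP.*-zeroˡ (Y σ))

    term-at : ∀ i σ → σ ≈ₚ zetaPerm i → term σ i ℚ.* Y σ ≡ 1/n ℚ.* Y (zetaPerm i)
    term-at i σ σ≈ζⁱ = ≡.cong₂ ℚ._*_
      (cong (if_then 1/n else 0ℚ) (dec-true (isZetaPow? σ i) (sym ∘ σ≈ζⁱ)))
      (y-ext (w ∘ₚ Perm.flip σ) (w ∘ₚ Perm.flip (zetaPerm i)) (flip-cong σ (zetaPerm i) σ≈ζⁱ ∘ (w ⟨$⟩ʳ_)))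

  shuffle-extensional : ∀ m k .{{_ : NonZero k}} → Extensional (shuffle m k)
  shuffle-extensional m k σ τ σ≈τ = cong (λ d → _/_ (+ ((suc m ℕ.+ k ∸ d ∸ 1) C suc m)) (k ^ suc m) {{m^n≢0 k (suc m)}})
    (des-cong (flip-cong σ τ σ≈τ))

open GroupAlgebra
open ℚListSum using (sumOver; sumOver-applyUpTo)
open ℕΣ using (sum-syntax)

mainTheorem1 : (m k : ℕ) → .{{nz : NonZero k}} → (w : Perm (suc m)) →
    (cut m · shuffle m k) w
    ≡ _/_ (+ ((suc m Data.Nat.+ k ∸ cdInv w ∸ 1) C m)) (suc m Data.Nat.* k ^ m) {{m*n≢0 (suc m) (k ^ m) {{_}} {{m^n≢0 k m}}}}
mainTheorem1 m k@(suc k′) w = begin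
  (cut m · shuffle m k) w
    ≡⟨ cut-·-coefficient m (shuffle m k) (shuffle-extensional m k) w ⟩
  1/n ℚ.* sumOver (upTo n) (λ i → shuffle m k (w ∘ₚ Perm.flip (zetaPerm i)))
    ≡⟨ cong (1/n ℚ.*_) (sumOver-applyUpTo id n (λ i → shuffle m k (w ∘ₚ Perm.flip (zetaPerm i)))) ⟩
  1/n ℚ.* ℚΣ.sum (λ j → _/_ (+ a j) (k ^ n) {{m^n≢0 k n}})
    ≡⟨ cong (1/n ℚ.*_) (∑[a/q]≡[∑a]/q n a (k ^ n) {{m^n≢0 k n}}) ⟩
  1/n ℚ.* _/_ (+ (∑[ j < n ] a j)) (k ^ n) {{m^n≢0 k n}}
    ≡⟨ cong (λ s → 1/n ℚ.* _/_ (+ s) (k ^ n) {{m^n≢0 k n}}) (∑-binomial-rotations m k′ inv⟨ w ⟩) ⟩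
  1/n ℚ.* _/_ (+ (k ℕ.* c)) (k ℕ.* k ^ m) {{m*n≢0 k (k ^ m) {{_}} {{m^n≢0 k m}}}}
    ≡⟨ 1/n*[k*a]/[k*p]≡a/[n*p] n k c (k ^ m) {{_}} {{_}} {{m^n≢0 k m}} ⟩
  _/_ (+ c) (n ℕ.* k ^ m) {{m*n≢0 n (k ^ m) {{_}} {{m^n≢0 k m}}}} ∎
  where
  open ≡.≡-Reasoning
  n : ℕ
  n = suc m
  1/n : ℚ
  1/n = + 1 / n
  a : Fin n → ℕ
  a j = (n ℕ.+ k ∸ des (inv⟨ w ⟩ ∘ zetaPow (toℕ j)) ∸ 1) C n
  c : ℕ
  c = (n ℕ.+ k ∸ cdInv w ∸ 1) C m
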